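{- Let $G$ be a finite simple connected graph, let $u\ne v$ be vertices of $G$, and fix a shortest path $v_1v_2\cdots v_k$ in $G$ with $v_1=u$, $v_k=v$. Write $\mathbf{e}=v_2v_4\cdots$ (product of the $v_i$ with $i$ even) and $\mathbf{o}=v_1v_3\cdots$ (product of the $v_i$ with $i$ odd), and $E=\{v_i: i \text{ even}\}$, $O=\{v_i: i\text{ odd}\}$. Every element of $\mathcal{P}_u(G)$ is uniquely of the form $\mathbf{w}u$ and every element of $\mathcal{P}_v(G)$ uniquely of the form $\mathbf{w}'v$ with $\mathbf{w},\mathbf{w}'\in\mathcal{P}^{\emptyset}(G)$. For such a pair set $H_1=\mathrm{IA}(\mathbf{w}\mathbf{e})$ and $H_2=\mathrm{IA}(\mathbf{w}'\mathbf{o})$. Let $\mathcal{H}$ be the set of pairs $(H_1,H_2)$ of disjoint subsets of $V(G)$ such that the subgraph $H$ induced by $G$ on $H_1\cup H_2$ is a connected bipartite graph with bipartition $(H_1,H_2)$ (so $H_1,H_2$ are independent), $E\subseteq H_1$, $O\subseteq H_2$, and $H_1\setminus E\subseteq N_G[u]$, $H_2\setminus O\subseteq N_G[v]$. For $(H_1,H_2)\in\mathcal{H}$ put $Z_1(H)=N_G[H_1\setminus E]\cup(N_G[H_1]\cap N_G[u])$ and $Z_2(H)=N_G[H_2\setminus O]\cup(N_G[H_2]\cap N_G[v])$. Then the map $$\mathcal{P}_u(G)\times\mathcal{P}_v(G)\longrightarrow\bigsqcup_{(H_1,H_2)\in\mathcal{H}}\mathcal{P}^{\emptyset}_{Z_1(H)}(G)\times\mathcal{P}^{\emptyset}_{Z_2(H)}(G),\qquad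 (\mathbf{w}u,\mathbf{w}'v)\mapsto\Big(\frac{\mathbf{w}\mathbf{e}}{\prod_{y\in H_1}y},\ \frac{\mathbf{w}'\mathbf{o}}{\prod_{y\in H_2}y}\Big),$$ where the image is placed in the component indexed by $(H_1,H_2)=(\mathrm{IA}(\mathbf{w}\mathbf{e}),\mathrm{IA}(\mathbf{w}'\mathbf{o}))$, is well defined and bijective.
   Context: $\mathcal{P}^{\emptyset}(G)$ is the monoid generated by $V(G)$ subject only to $ab=ba$ for distinct non-adjacent $a,b$; elements are words, $\mathcal{P}(G)$ is the set of non-empty words. The initial alphabet $\mathrm{IA}(\mathbf{w})$ of a non-empty word $\mathbf{w}$ is the set of $x$ with $\mathbf{w}=\mathbf{z}x$ for some word $\mathbf{z}$; it is always an independent set. For $S\subseteq V(G)$, $\mathcal{P}_S(G)$ is the set of non-empty words with $\mathrm{IA}\subseteq S$, $\mathcal{P}^{\emptyset}_S(G)=\mathcal{P}_S(G)\cup\{\text{empty word}\}$, and $\mathcal{P}_x(G)=\mathcal{P}_{\{x\}}(G)$. For an independent set $K$ and a word $\mathbf{z}$ with $\mathrm{IA}(\mathbf{z})=K$, $\mathbf{z}/\prod_{y\in K}y$ is the unique word $\mathbf{z}'$ with $\mathbf{z}=\mathbf{z}'\prod_{y\in K}y$. For $A\subseteq V(G)$, $N_G[A]=\bigcup_{a\in A}(N_G(a)\cup\{a\})$, and $N_G[u]=N_G[\{u\}]$. -}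

module Defs where

open import Level using (0ℓ)
open import Data.Nat using (ℕ; _≤_)
open import Data.Fin using (Fin)
open import Data.Fin.Subset using (Subset; _∈_; _∉_; _∪_)
open import Data.Fin.Subset.Properties using (_∈?_)
open import Data.List using (List; []; _∷_; _++_; [_]; length; filter; allFin)
open import Data.List.Relation.Unary.All using (All)
open import Data.List.Membership.Propositional using () renaming (_∈_ to _∈ₗ_)
open import Data.Product using (Σ; ∃; ∃-syntax; _×_; _,_)
open import Data.Sum using (_⊎_)
open import Relation.Nullary using (¬_; Dec)
open import Relation.Binary.PropositionalEquality using (_≡_; _≢_)
open import Function.Bundles using (_⇔_)

record SimpleGraph (n : ℕ) : Set₁ where
  field
    _~_     : Fin n → Fin n → Set
    ~-sym   : ∀ {a b} → a ~ b → b ~ a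
    ~-irrefl : ∀ {a} → ¬ (a ~ a)
    ~-dec   : ∀ a b → Dec (a ~ b)

module _ {n : ℕ} (G : SimpleGraph n) where
  open SimpleGraph G

  data Walk : Fin n → Fin n → List (Fin n) → Set where
    here : ∀ {a} → Walk a a (a ∷ [])
    step : ∀ {a b c ps} → a ~ b → Walk b c ps → Walk a c (a ∷ ps)

  Connected : Set
  Connected = ∀ a b → ∃[ ps ] Walk a b ps

  ShortestPath : Fin n → Fin n → List (Fin n) → Set
  ShortestPath u v ps =
    Walk u v ps × (∀ qs → Walk u v qs → length ps ≤ length qs)

  N[_] : Fin n → Fin n → Set
  N[ y ] x = x ≡ y ⊎ y ~ x

  Independent : Subset n → Set
  Independent S = ∀ a b → a ∈ S → b ∈ S → ¬ (a ~ b)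

  InducedConnected : Subset n → Set
  InducedConnected S =
    ∀ a b → a ∈ S → b ∈ S → ∃[ ps ] (Walk a b ps × All (_∈ S) ps)

  -- The partially commutative monoid P^∅(G): words are lists of vertices
  -- (read left to right), identified up to the congruence generated by
  -- ab = ba for distinct non-adjacent a, b.

  infix 4 _≈_
  data _≈_ : List (Fin n) → List (Fin n) → Set where
    ≈-refl  : ∀ {w} → w ≈ w
    ≈-sym   : ∀ {w w'} → w ≈ w' → w' ≈ w
    ≈-trans : ∀ {w w' w''} → w ≈ w' → w' ≈ w'' → w ≈ w''
    ≈-swap  : ∀ xs ys a b → a ≢ b → ¬ (a ~ b) →
              (xs ++ a ∷ b ∷ ys) ≈ (xs ++ b ∷ a ∷ ys)

  InIA : List (Fin n) → Fin n → Set
  InIA w x = ∃[ z ] (w ≈ z ++ [ x ])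

  IsIA : List (Fin n) → Subset n → Set
  IsIA w H = ∀ x → (x ∈ H ⇔ InIA w x)

  InP∅ : (Fin n → Set) → List (Fin n) → Set
  InP∅ S w = ∀ x → InIA w x → S x

  InP : (Fin n → Set) → List (Fin n) → Set
  InP S w = (w ≢ []) × InP∅ S w

-- ∏_{y ∈ H} y  (in increasing order of vertices; for independent H the
-- order is irrelevant up to ≈)
prodSet : ∀ {n} → Subset n → List (Fin n)
prodSet {n} H = filter (_∈? H) (allFin n)

-- v₁ v₃ ⋯ (odd positions) and v₂ v₄ ⋯ (even positions), 1-indexed
oddPos evenPos : ∀ {A : Set} → List A → List A
oddPos [] = []
oddPos (x ∷ xs) = x ∷ evenPos xs
evenPos [] = []
evenPos (x ∷ xs) = oddPos xs

module Prop41 {n : ℕ} (G : SimpleGraph n) (u v : Fin n) (ps : List (Fin n)) where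
  open SimpleGraph G

  𝐞 𝐨 : List (Fin n)
  𝐞 = evenPos ps
  𝐨 = oddPos ps

  InE InO : Fin n → Set
  InE x = x ∈ₗ 𝐞
  InO x = x ∈ₗ 𝐨

  Inℋ : Subset n → Subset n → Set
  Inℋ H₁ H₂ =
      (∀ x → x ∈ H₁ → x ∉ H₂)
    × Independent G H₁
    × Independent G H₂
    × InducedConnected G (H₁ ∪ H₂)
    × (∀ x → InE x → x ∈ H₁)
    × (∀ x → InO x → x ∈ H₂)
    × (∀ x → x ∈ H₁ → ¬ InE x → N[ G ] u x)
    × (∀ x → x ∈ H₂ → ¬ InO x → N[ G ] v x)

  Z₁ : Subset n → Fin n → Set
  Z₁ H₁ x = (∃[ y ] (y ∈ H₁ × ¬ InE y × N[ G ] y x))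
          ⊎ ((∃[ y ] (y ∈ H₁ × N[ G ] y x)) × N[ G ] u x)

  Z₂ : Subset n → Fin n → Set
  Z₂ H₂ x = (∃[ y ] (y ∈ H₂ × ¬ InO y × N[ G ] y x))
          ⊎ ((∃[ y ] (y ∈ H₂ × N[ G ] y x)) × N[ G ] v x)

  -- elements of the disjoint union  ⨆_{(H₁,H₂)∈ℋ} P^∅_{Z₁(H)} × P^∅_{Z₂(H)}
  Target : Set
  Target = Subset n × Subset n × List (Fin n) × List (Fin n)

  InCodomain : Target → Set
  InCodomain (H₁ , H₂ , a , b) =
    Inℋ H₁ H₂ × InP∅ G (Z₁ H₁) a × InP∅ G (Z₂ H₂) b

  _≈T_ : Target → Target → Set
  (H₁ , H₂ , a , b) ≈T (H₁' , H₂' , a' , b') =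
    H₁ ≡ H₁' × H₂ ≡ H₂' × _≈_ G a a' × _≈_ G b b'

  InDomain : List (Fin n) → List (Fin n) → Set
  InDomain x y = InP G (_≡ u) x × InP G (_≡ v) y

  -- graph of the map:  (𝐰u, 𝐰'v) ↦ (𝐰𝐞 / ∏H₁ , 𝐰'𝐨 / ∏H₂) in component (H₁,H₂)
  Maps : List (Fin n) → List (Fin n) → Target → Set
  Maps x y (H₁ , H₂ , a , b) =
    ∃[ w ] ∃[ w' ]
      ( _≈_ G x (w ++ [ u ])
      × _≈_ G y (w' ++ [ v ])
      × IsIA G (w ++ 𝐞) H₁
      × IsIA G (w' ++ 𝐨) H₂
      × _≈_ G (w ++ 𝐞) (a ++ prodSet H₁)
      × _≈_ G (w' ++ 𝐨) (b ++ prodSet H₂) )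

  WellDefinedBijection : Set
  WellDefinedBijection =
      (∀ x → InP G (_≡ u) x → ∃[ w ] _≈_ G x (w ++ [ u ]))
    × (∀ w w' → _≈_ G (w ++ [ u ]) (w' ++ [ u ]) → _≈_ G w w')
    × (∀ y → InP G (_≡ v) y → ∃[ w ] _≈_ G y (w ++ [ v ]))
    × (∀ w w' → _≈_ G (w ++ [ v ]) (w' ++ [ v ]) → _≈_ G w w')
    × (∀ x y → InDomain x y → ∃[ t ] (InCodomain t × Maps x y t))
    × (∀ x y x' y' t t' → InDomain x y → InDomain x' y' →
         Maps x y t → Maps x' y' t' → _≈_ G x x' → _≈_ G y y' → t ≈T t')
    × (∀ x y x' y' t t' → InDomain x y → InDomain x' y' →
         Maps x y t → Maps x' y' t' → t ≈T t' → _≈_ G x x' × _≈_ G y y')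
    × (∀ t → InCodomain t → ∃[ x ] ∃[ y ] (InDomain x y × Maps x y t))

{-# OPTIONS --safe #-}
-- The map splits into two independent one-sided maps, one for (w, u, e) and one for (w', v, o).
-- Since ps is a shortest, hence induced, path, the letters of e pairwise commute; so
-- IA(w e) = H₁ consists of E together with those final letters of w that commute with e, and the
-- latter lie in N[u] because IA(w u) = {u}. Moving them to the end, w = w₀ (H₁ ∖ E) and
-- w e = w₀ ∏H₁, and every final letter of w₀ is blocked by H₁ ∖ E or lies in N[H₁] ∩ N[u],
-- i.e. w₀ ∈ P∅_{Z₁}. Conversely (H₁, a) comes from w = a (H₁ ∖ E). Single-valuedness and
-- injectivity are right cancellation in the trace monoid: deleting the last occurrence of a
-- letter respects the commutation relation. Disjointness and connectedness of H₁ ∪ H₂ hold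
-- because each vertex of H₁ ∪ H₂ lies on the path or next to one of its end points.
module Submission where

open import Defs
open import Data.Nat using (ℕ; suc; _≤_; _<_; s≤s)
open import Data.Nat.Properties using (m≤n+m; <⇒≱)
open import Data.Unit using (⊤; tt)
open import Data.Empty using (⊥-elim)
open import Data.Product using (∃; ∃₂; ∃-syntax; _×_; _,_; proj₁; proj₂; uncurry)
open import Data.Sum using (_⊎_; inj₁; inj₂) renaming ([_,_] to either)
open import Data.Fin using (Fin)
open import Data.Fin.Properties using (_≟_)
open import Data.Fin.Subset using (Subset; _∈_; _∉_; _∪_)
open import Data.Fin.Subset.Properties using (_∈?_; ⊆-antisym; x∈p∪q⁺; x∈p∪q⁻)
open import Data.Vec using (tabulate)
open import Data.Vec.Properties using (lookup∘tabulate; []=⇒lookup; lookup⇒[]=)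
open import Data.List using (List; []; _∷_; _++_; [_]; length; drop; filter; allFin; initLast; _∷ʳ′_)
open import Data.List.Properties using (++-assoc; ++-identityʳ; length-++)
open import Data.List.Relation.Unary.All as All using (All; []; _∷_)
import Data.List.Relation.Unary.All.Properties as All
open import Data.List.Relation.Unary.Any using (Any; here; there; any?)
open import Data.List.Relation.Unary.AllPairs using (AllPairs; []; _∷_)
import Data.List.Relation.Unary.AllPairs.Properties as AllPairs
open import Data.List.Relation.Unary.Unique.Propositional using (Unique)
import Data.List.Relation.Unary.Unique.Propositional.Properties as Unique
open import Data.List.Membership.Propositional using (find) renaming (_∈_ to _∈ₗ_; _∉_ to _∉ₗ_)
open import Data.List.Membership.Propositional.Properties
  using (∈-++⁺ˡ; ∈-++⁺ʳ; ∈-++⁻; ∈-filter⁺; ∈-filter⁻; ∈-allFin; ∈-∃++)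
open import Function using (_∘_; id)
open import Function.Bundles using (Equivalence; mk⇔)
open import Relation.Nullary using (¬_; Dec; yes; no; does)
open import Relation.Nullary.Decidable using (dec-true; _×-dec_; ¬?)
open import Relation.Binary.PropositionalEquality using (_≡_; _≢_; refl; sym; trans; cong; subst; subst₂)

module Words {n : ℕ} (G : SimpleGraph n) where
  open SimpleGraph G
  open import Data.List.Membership.DecPropositional (_≟_ {n}) using () renaming (_∈?_ to _∈ₗ?_)

  Vertex : Set
  Vertex = Fin n

  Word : Set
  Word = List Vertex

  infix 4 _≋_
  _≋_ : Word → Word → Set
  _≋_ = _≈_ G

  ≡⇒≋ : ∀ {w w'} → w ≡ w' → w ≋ w'
  ≡⇒≋ refl = ≈-refl

  Commute : Vertex → Vertex → Set
  Commute x y = x ≢ y × ¬ x ~ y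

  commute-sym : ∀ {x y} → Commute x y → Commute y x
  commute-sym (x≢y , x≁y) = x≢y ∘ sym , x≁y ∘ ~-sym

  commute-irrefl : ∀ {x} → ¬ Commute x x
  commute-irrefl (x≢x , _) = x≢x refl

  commute? : ∀ x y → Dec (Commute x y)
  commute? x y with x ≟ y | ~-dec x y
  ... | yes x≡y | _       = no (λ c → proj₁ c x≡y)
  ... | no _    | yes x~y = no (λ c → proj₂ c x~y)
  ... | no x≢y  | no x≁y  = yes (x≢y , x≁y)

  N⇒¬commute : ∀ {y z} → N[ G ] y z → ¬ Commute z y
  N⇒¬commute (inj₁ z≡y) (z≢y , _) = z≢y z≡y
  N⇒¬commute (inj₂ y~z) (_ , z≁y) = z≁y (~-sym y~z)

  ¬commute⇒N : ∀ {y z} → ¬ Commute z y → N[ G ] y z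
  ¬commute⇒N {y} {z} ¬c with z ≟ y | ~-dec y z
  ... | yes z≡y | _       = inj₁ z≡y
  ... | no _    | yes y~z = inj₂ y~z
  ... | no z≢y  | no y≁z  = ⊥-elim (¬c (z≢y , y≁z ∘ ~-sym))

  ≋-++ˡ : ∀ l {r r'} → r ≋ r' → l ++ r ≋ l ++ r'
  ≋-++ˡ l ≈-refl        = ≈-refl
  ≋-++ˡ l (≈-sym e)     = ≈-sym (≋-++ˡ l e)
  ≋-++ˡ l (≈-trans e f) = ≈-trans (≋-++ˡ l e) (≋-++ˡ l f)
  ≋-++ˡ l (≈-swap xs ys a b a≢b a≁b) =
    subst₂ _≋_ (++-assoc l xs _) (++-assoc l xs _) (≈-swap (l ++ xs) ys a b a≢b a≁b)

  ≋-++ʳ : ∀ {l l'} r → l ≋ l' → l ++ r ≋ l' ++ r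
  ≋-++ʳ r ≈-refl        = ≈-refl
  ≋-++ʳ r (≈-sym e)     = ≈-sym (≋-++ʳ r e)
  ≋-++ʳ r (≈-trans e f) = ≈-trans (≋-++ʳ r e) (≋-++ʳ r f)
  ≋-++ʳ r (≈-swap xs ys a b a≢b a≁b) =
    subst₂ _≋_ (sym (++-assoc xs (a ∷ b ∷ ys) r)) (sym (++-assoc xs (b ∷ a ∷ ys) r))
      (≈-swap xs (ys ++ r) a b a≢b a≁b)

  SwapInvariant : (Word → Set) → Set
  SwapInvariant P = ∀ xs ys a b → Commute a b → P (xs ++ a ∷ b ∷ ys) → P (xs ++ b ∷ a ∷ ys)

  ≋-resp : ∀ {P} → SwapInvariant P → ∀ {w w'} → w ≋ w' → (P w → P w') × (P w' → P w)
  ≋-resp I ≈-refl        = id , id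
  ≋-resp I (≈-sym e)     = proj₂ (≋-resp I e) , proj₁ (≋-resp I e)
  ≋-resp I (≈-trans e f) =
    proj₁ (≋-resp I f) ∘ proj₁ (≋-resp I e) , proj₂ (≋-resp I e) ∘ proj₂ (≋-resp I f)
  ≋-resp I (≈-swap xs ys a b a≢b a≁b) =
    I xs ys a b (a≢b , a≁b) , I xs ys b a (commute-sym (a≢b , a≁b))

  ≋-transport : ∀ {P} → SwapInvariant P → ∀ {w w'} → w ≋ w' → P w → P w'
  ≋-transport I e = proj₁ (≋-resp I e)

  All-swap : ∀ {P : Vertex → Set} → SwapInvariant (All P)
  All-swap []       ys a b _ (pa ∷ pb ∷ pys) = pb ∷ pa ∷ pys
  All-swap (x ∷ xs) ys a b c (px ∷ pxs)     = px ∷ All-swap xs ys a b c pxs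

  AllPairs-swap : SwapInvariant (AllPairs Commute)
  AllPairs-swap []       ys a b _ ((cab ∷ ca) ∷ cb ∷ cys) = (commute-sym cab ∷ cb) ∷ ca ∷ cys
  AllPairs-swap (x ∷ xs) ys a b c (cx ∷ cxs) = All-swap xs ys a b c cx ∷ AllPairs-swap xs ys a b c cxs

  -- A syntactic, decidable stand-in for InIA w x.
  data Final (x : Vertex) : Word → Set where
    here  : ∀ {ys} → All (Commute x) ys → Final x (x ∷ ys)
    there : ∀ {y ys} → Final x ys → Final x (y ∷ ys)

  Final⇒∈ : ∀ {x w} → Final x w → x ∈ₗ w
  Final⇒∈ (here _)  = here refl
  Final⇒∈ (there f) = there (Final⇒∈ f)

  final? : ∀ x w → Dec (Final x w)
  final? x []       = no (λ ())
  final? x (y ∷ ys) with final? x ys | y ≟ x | All.all? (commute? x) ys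
  ... | yes f  | _        | _     = yes (there f)
  ... | no ¬f  | yes refl | yes c = yes (here c)
  ... | no ¬f  | no y≢x   | _     = no λ { (here _) → y≢x refl ; (there f) → ¬f f }
  ... | no ¬f  | yes refl | no ¬c = no λ { (here c) → ¬c c ; (there f) → ¬f f }

  Final-++⁺ʳ : ∀ {x} l {r} → Final x r → Final x (l ++ r)
  Final-++⁺ʳ []      f = f
  Final-++⁺ʳ (_ ∷ l) f = there (Final-++⁺ʳ l f)

  Final-++⁺ˡ : ∀ {x l r} → Final x l → All (Commute x) r → Final x (l ++ r)
  Final-++⁺ˡ (here c)  cr = here (All.++⁺ c cr)
  Final-++⁺ˡ (there f) cr = there (Final-++⁺ˡ f cr)

  Final-++⁻ : ∀ {x} l {r} → Final x (l ++ r) → Final x r ⊎ (Final x l × All (Commute x) r)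
  Final-++⁻ []      f         = inj₁ f
  Final-++⁻ (_ ∷ l) (here c)  = inj₂ (here (All.++⁻ˡ l c) , All.++⁻ʳ l c)
  Final-++⁻ (_ ∷ l) (there f) with Final-++⁻ l f
  ... | inj₁ fr        = inj₁ fr
  ... | inj₂ (fl , cr) = inj₂ (there fl , cr)

  Final-swap : ∀ {x} → SwapInvariant (Final x)
  Final-swap {x} xs ys a b c f with Final-++⁻ xs f
  ... | inj₂ (fxs , cr) = Final-++⁺ˡ fxs (All-swap [] ys a b c cr)
  ... | inj₁ fr         = Final-++⁺ʳ xs (swap₂ fr)
    where
    swap₂ : Final x (a ∷ b ∷ ys) → Final x (b ∷ a ∷ ys)
    swap₂ (here (_ ∷ cys))       = there (here cys)
    swap₂ (there (here cys))     = here (commute-sym c ∷ cys)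
    swap₂ (there (there f))      = there (there f)

  Final-resp-≋ : ∀ {x w w'} → w ≋ w' → Final x w → Final x w'
  Final-resp-≋ = ≋-transport Final-swap

  Final-split : ∀ {x w} → Final x w → ∃₂ λ l r → w ≡ l ++ x ∷ r × All (Commute x) r
  Final-split (here c) = [] , _ , refl , c
  Final-split {w = y ∷ _} (there f) with Final-split f
  ... | l , r , refl , c = y ∷ l , r , refl , c

  commute-past : ∀ {x} l r → All (Commute x) r → l ++ x ∷ r ≋ (l ++ r) ++ [ x ]
  commute-past l []      []       = ≡⇒≋ (sym (cong (_++ _) (++-identityʳ l)))
  commute-past {x} l (y ∷ r) ((x≢y , x≁y) ∷ c) =
    ≈-trans (≈-swap l r x y x≢y x≁y)
      (subst₂ _≋_ (++-assoc l [ y ] (x ∷ r)) (cong (_++ [ x ]) (++-assoc l [ y ] r))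
        (commute-past (l ++ [ y ]) r c))

  Final⇒InIA : ∀ {x w} → Final x w → InIA G w x
  Final⇒InIA f with Final-split f
  ... | l , r , refl , c = l ++ r , commute-past l r c

  InIA⇒Final : ∀ {x w} → InIA G w x → Final x w
  InIA⇒Final (z , e) = Final-resp-≋ (≈-sym e) (Final-++⁺ʳ z (here []))

  deleteLast : Vertex → Word → Word
  deleteLast x []       = []
  deleteLast x (y ∷ ys) with x ∈ₗ? ys | y ≟ x
  ... | yes _ | _     = y ∷ deleteLast x ys
  ... | no _  | yes _ = ys
  ... | no _  | no _  = y ∷ ys

  deleteLast-∈ : ∀ {x} y {ys} → x ∈ₗ ys → deleteLast x (y ∷ ys) ≡ y ∷ deleteLast x ys
  deleteLast-∈ {x} y {ys} x∈ys with x ∈ₗ? ys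
  ... | yes _   = refl
  ... | no x∉ys = ⊥-elim (x∉ys x∈ys)

  deleteLast-head : ∀ {x y} ys → y ≡ x → x ∉ₗ ys → deleteLast x (y ∷ ys) ≡ ys
  deleteLast-head {x} {y} ys y≡x x∉ys with x ∈ₗ? ys | y ≟ x
  ... | yes x∈ys | _      = ⊥-elim (x∉ys x∈ys)
  ... | no _     | yes _  = refl
  ... | no _     | no y≢x = ⊥-elim (y≢x y≡x)

  deleteLast-∉ : ∀ {x} ys → x ∉ₗ ys → deleteLast x ys ≡ ys
  deleteLast-∉ []       _     = refl
  deleteLast-∉ {x} (y ∷ ys) x∉y∷ys with x ∈ₗ? ys | y ≟ x
  ... | yes x∈ys | _        = ⊥-elim (x∉y∷ys (there x∈ys))
  ... | no _     | yes refl = ⊥-elim (x∉y∷ys (here refl))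
  ... | no _     | no _     = refl

  deleteLast-++-∈ʳ : ∀ {x} l {r} → x ∈ₗ r → deleteLast x (l ++ r) ≡ l ++ deleteLast x r
  deleteLast-++-∈ʳ []      _    = refl
  deleteLast-++-∈ʳ (y ∷ l) x∈r =
    trans (deleteLast-∈ y (∈-++⁺ʳ l x∈r)) (cong (y ∷_) (deleteLast-++-∈ʳ l x∈r))

  deleteLast-++-∉ʳ : ∀ {x} l {r} → x ∉ₗ r → deleteLast x (l ++ r) ≡ deleteLast x l ++ r
  deleteLast-++-∉ʳ [] x∉r = deleteLast-∉ _ x∉r
  deleteLast-++-∉ʳ {x} (y ∷ l) {r} x∉r with x ∈ₗ? l | x ∈ₗ? (l ++ r) | y ≟ x
  ... | yes _   | yes _     | _     = cong (y ∷_) (deleteLast-++-∉ʳ l x∉r)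
  ... | yes x∈l | no x∉l++r | _     = ⊥-elim (x∉l++r (∈-++⁺ˡ x∈l))
  ... | no x∉l  | yes x∈l++r | _    = ⊥-elim (either x∉l x∉r (∈-++⁻ l x∈l++r))
  ... | no _    | no _      | yes _ = refl
  ... | no _    | no _      | no _  = refl

  deleteLast-swap₂ : ∀ x {a b} ys → Commute a b → deleteLast x (a ∷ b ∷ ys) ≋ deleteLast x (b ∷ a ∷ ys)
  deleteLast-swap₂ x {a} {b} ys (a≢b , a≁b) = cases (x ∈ₗ? ys) (a ≟ x) (b ≟ x)
    where
    x∉∷ : ∀ {c zs} → c ≢ x → x ∉ₗ zs → x ∉ₗ c ∷ zs
    x∉∷ c≢x x∉zs (here x≡c)   = c≢x (sym x≡c)
    x∉∷ c≢x x∉zs (there x∈zs) = x∉zs x∈zs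

    deleteLast-pair-∈ : ∀ c d → x ∈ₗ ys → deleteLast x (c ∷ d ∷ ys) ≡ c ∷ d ∷ deleteLast x ys
    deleteLast-pair-∈ c d x∈ys = trans (deleteLast-∈ c (there x∈ys)) (cong (c ∷_) (deleteLast-∈ d x∈ys))

    deleteLast-second : ∀ c {d} → d ≡ x → x ∉ₗ ys → deleteLast x (c ∷ d ∷ ys) ≡ c ∷ ys
    deleteLast-second c d≡x x∉ys =
      trans (deleteLast-∈ c (here (sym d≡x))) (cong (c ∷_) (deleteLast-head ys d≡x x∉ys))

    cases : Dec (x ∈ₗ ys) → Dec (a ≡ x) → Dec (b ≡ x) →
            deleteLast x (a ∷ b ∷ ys) ≋ deleteLast x (b ∷ a ∷ ys)
    cases (yes x∈ys) _ _ =
      subst₂ _≋_ (sym (deleteLast-pair-∈ a b x∈ys)) (sym (deleteLast-pair-∈ b a x∈ys))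
        (≈-swap [] (deleteLast x ys) a b a≢b a≁b)
    cases (no x∉ys) (yes a≡x) (yes b≡x) = ⊥-elim (a≢b (trans a≡x (sym b≡x)))
    cases (no x∉ys) (yes a≡x) (no b≢x) =
      ≡⇒≋ (trans (deleteLast-head (b ∷ ys) a≡x (x∉∷ b≢x x∉ys)) (sym (deleteLast-second b a≡x x∉ys)))
    cases (no x∉ys) (no a≢x) (yes b≡x) =
      ≡⇒≋ (trans (deleteLast-second a b≡x x∉ys) (sym (deleteLast-head (a ∷ ys) b≡x (x∉∷ a≢x x∉ys))))
    cases (no x∉ys) (no a≢x) (no b≢x) =
      subst₂ _≋_ (sym (deleteLast-∉ _ (x∉∷ a≢x (x∉∷ b≢x x∉ys))))
                 (sym (deleteLast-∉ _ (x∉∷ b≢x (x∉∷ a≢x x∉ys))))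
        (≈-swap [] ys a b a≢b a≁b)

  deleteLast-resp-≋ : ∀ x {w w'} → w ≋ w' → deleteLast x w ≋ deleteLast x w'
  deleteLast-resp-≋ x ≈-refl        = ≈-refl
  deleteLast-resp-≋ x (≈-sym e)     = ≈-sym (deleteLast-resp-≋ x e)
  deleteLast-resp-≋ x (≈-trans e f) = ≈-trans (deleteLast-resp-≋ x e) (deleteLast-resp-≋ x f)
  deleteLast-resp-≋ x (≈-swap xs ys a b a≢b a≁b) with x ∈ₗ? (a ∷ b ∷ ys)
  ... | yes x∈ =
    subst₂ _≋_ (sym (deleteLast-++-∈ʳ xs x∈)) (sym (deleteLast-++-∈ʳ xs (∈-swap₂ x∈)))
      (≋-++ˡ xs (deleteLast-swap₂ x ys (a≢b , a≁b)))
    where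
    ∈-swap₂ : x ∈ₗ a ∷ b ∷ ys → x ∈ₗ b ∷ a ∷ ys
    ∈-swap₂ (here x≡a)         = there (here x≡a)
    ∈-swap₂ (there (here x≡b)) = here x≡b
    ∈-swap₂ (there (there p))  = there (there p)
  ... | no x∉ =
    subst₂ _≋_ (sym (deleteLast-++-∉ʳ xs x∉)) (sym (deleteLast-++-∉ʳ xs (x∉ ∘ ∈-swap₂)))
      (≈-swap (deleteLast x xs) ys a b a≢b a≁b)
    where
    ∈-swap₂ : x ∈ₗ b ∷ a ∷ ys → x ∈ₗ a ∷ b ∷ ys
    ∈-swap₂ (here x≡b)         = there (here x≡b)
    ∈-swap₂ (there (here x≡a)) = here x≡a
    ∈-swap₂ (there (there p))  = there (there p)

  deleteLast-∷ʳ : ∀ x w → deleteLast x (w ++ [ x ]) ≡ w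
  deleteLast-∷ʳ x w = trans (deleteLast-++-∈ʳ w (here refl))
                            (trans (cong (w ++_) (deleteLast-head [] refl λ ())) (++-identityʳ w))

  ∷ʳ-cancel-≋ : ∀ {x} w w' → w ++ [ x ] ≋ w' ++ [ x ] → w ≋ w'
  ∷ʳ-cancel-≋ {x} w w' e = subst₂ _≋_ (deleteLast-∷ʳ x w) (deleteLast-∷ʳ x w') (deleteLast-resp-≋ x e)

  ++-cancelʳ-≋ : ∀ p l l' → l ++ p ≋ l' ++ p → l ≋ l'
  ++-cancelʳ-≋ []      l l' e = subst₂ _≋_ (++-identityʳ l) (++-identityʳ l') e
  ++-cancelʳ-≋ (y ∷ p) l l' e =
    ∷ʳ-cancel-≋ l l' (++-cancelʳ-≋ p (l ++ [ y ]) (l' ++ [ y ])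
      (subst₂ _≋_ (sym (++-assoc l [ y ] p)) (sym (++-assoc l' [ y ] p)) e))

  final-exists : ∀ w → w ≢ [] → ∃ λ x → Final x w
  final-exists []           w≢[] = ⊥-elim (w≢[] refl)
  final-exists (y ∷ [])     _    = y , here []
  final-exists (y ∷ z ∷ zs) _    with final-exists (z ∷ zs) (λ ())
  ... | x , f = x , there f

  Final-independent : ∀ {a b w} → Final a w → Final b w → ¬ a ~ b
  Final-independent (here _)  (here _)  a~a = ~-irrefl a~a
  Final-independent (here c)  (there f) a~b = proj₂ (All.lookup c (Final⇒∈ f)) a~b
  Final-independent (there f) (here c)  a~b = proj₂ (All.lookup c (Final⇒∈ f)) (~-sym a~b)
  Final-independent (there f) (there g) a~b = Final-independent f g a~b

  AllPairs⇒Final : ∀ {x L} → AllPairs Commute L → x ∈ₗ L → Final x L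
  AllPairs⇒Final (c ∷ _)  (here refl) = here c
  AllPairs⇒Final (_ ∷ cs) (there x∈L) = there (AllPairs⇒Final cs x∈L)

  AllPairs-++⇒All : ∀ {x} l {r} → AllPairs Commute (l ++ r) → x ∈ₗ l → All (Commute x) r
  AllPairs-++⇒All (_ ∷ l) (c ∷ _)  (here refl) = All.++⁻ʳ l c
  AllPairs-++⇒All (_ ∷ l) (_ ∷ cs) (there x∈l) = AllPairs-++⇒All l cs x∈l

  factor-finals : ∀ w L → AllPairs Commute L → All (λ y → Final y w) L → ∃ λ w₀ → w ≋ w₀ ++ L
  factor-finals w []      _         _         = w , ≡⇒≋ (sym (++-identityʳ w))
  factor-finals w (x ∷ L) (cx ∷ cL) (fx ∷ fL) with factor-finals w L cL fL
  ... | w₁ , w≋w₁L with Final-++⁻ w₁ (Final-resp-≋ w≋w₁L fx)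
  ...   | inj₁ fxL       = ⊥-elim (commute-irrefl (All.lookup cx (Final⇒∈ fxL)))
  ...   | inj₂ (fxw₁ , _) with Final⇒InIA fxw₁
  ...     | z , w₁≋zx = z , ≈-trans w≋w₁L (subst (w₁ ++ L ≋_) (++-assoc z [ x ] L) (≋-++ʳ L w₁≋zx))

  commuting-≋ : ∀ L L' → AllPairs Commute L → AllPairs Commute L' →
                (∀ {x} → x ∈ₗ L' → x ∈ₗ L) → (∀ {x} → x ∈ₗ L → x ∈ₗ L') → L ≋ L'
  commuting-≋ L L' cL cL' L'⊆L L⊆L'
    with factor-finals L L' cL' (All.tabulate (AllPairs⇒Final cL ∘ L'⊆L))
  ... | [] , L≋L' = L≋L'
  ... | w₀@(_ ∷ _) , L≋w₀L' with final-exists w₀ (λ ())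
  ...   | x , fx = ⊥-elim (commute-irrefl (All.lookup x⋈L' (L⊆L' (Final⇒∈ fxL))))
    where
    x⋈L' : All (Commute x) L'
    x⋈L' = AllPairs-++⇒All w₀ (≋-transport AllPairs-swap L≋w₀L' cL) (Final⇒∈ fx)
    fxL : Final x L
    fxL = Final-resp-≋ (≈-sym L≋w₀L') (Final-++⁺ˡ fx x⋈L')

  blocked-or-commutes : ∀ z L → (∃ λ y → y ∈ₗ L × N[ G ] y z) ⊎ All (Commute z) L
  blocked-or-commutes z []      = inj₂ []
  blocked-or-commutes z (y ∷ L) with commute? z y | blocked-or-commutes z L
  ... | no ¬z⋈y | _                    = inj₁ (y , here refl , ¬commute⇒N ¬z⋈y)
  ... | yes _   | inj₁ (y' , y'∈L , N) = inj₁ (y' , there y'∈L , N)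
  ... | yes z⋈y | inj₂ z⋈L            = inj₂ (z⋈y ∷ z⋈L)

  InP∅-resp-≋ : ∀ {S w w'} → w ≋ w' → InP∅ G S w → InP∅ G S w'
  InP∅-resp-≋ w≋w' w∈P x (z , w'≋zx) = w∈P x (z , ≈-trans w≋w' w'≋zx)

  InP-single⇒∷ʳ : ∀ c x → InP G (_≡ c) x → ∃ λ w → x ≋ w ++ [ c ]
  InP-single⇒∷ʳ c x (x≢[] , IA⊆c) with initLast x
  ... | []        = ⊥-elim (x≢[] refl)
  ... | w ∷ʳ′ y with IA⊆c y (w , ≈-refl)
  ...   | refl = w , ≈-refl

  ∷ʳ≢[] : ∀ (w : Word) c → w ++ [ c ] ≢ []
  ∷ʳ≢[] []      c ()
  ∷ʳ≢[] (_ ∷ _) c ()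

  Final⇒N : ∀ {c x w} → InP∅ G (_≡ c) (w ++ [ c ]) → Final x w → N[ G ] c x
  Final⇒N {c} {x} {w} IA⊆c fx with x ≟ c
  ... | yes x≡c = inj₁ x≡c
  ... | no x≢c  = ¬commute⇒N (λ x⋈c → x≢c (IA⊆c x (Final⇒InIA (Final-++⁺ˡ fx (x⋈c ∷ [])))))

  subsetOf : {P : Vertex → Set} → (∀ x → Dec (P x)) → Subset n
  subsetOf P? = tabulate (does ∘ P?)

  ∈-subsetOf⁺ : ∀ {P : Vertex → Set} (P? : ∀ x → Dec (P x)) {x} → P x → x ∈ subsetOf P?
  ∈-subsetOf⁺ P? {x} px = lookup⇒[]= x _ (trans (lookup∘tabulate _ x) (dec-true (P? x) px))

  ∈-subsetOf⁻ : ∀ {P : Vertex → Set} (P? : ∀ x → Dec (P x)) {x} → x ∈ subsetOf P? → P x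
  ∈-subsetOf⁻ P? {x} x∈ with P? x | trans (sym (lookup∘tabulate (does ∘ P?) x)) ([]=⇒lookup x∈)
  ... | yes px | _ = px
  ... | no _   | ()

  ∈-prodSet⁺ : ∀ {H : Subset n} {x} → x ∈ H → x ∈ₗ prodSet H
  ∈-prodSet⁺ {H} {x} x∈H = ∈-filter⁺ (_∈? H) (∈-allFin x) x∈H

  ∈-prodSet⁻ : ∀ {H : Subset n} {x} → x ∈ₗ prodSet H → x ∈ H
  ∈-prodSet⁻ {H} x∈ = proj₂ (∈-filter⁻ (_∈? H) {xs = allFin n} x∈)

  independent⇒pairwise : ∀ {H L} → Independent G H → Unique L → All (_∈ H) L → AllPairs Commute L
  independent⇒pairwise ind []            []             = []
  independent⇒pairwise ind (x≢L ∷ uniq) (x∈H ∷ L⊆H) =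
    All.zipWith (λ (x≢y , y∈H) → x≢y , ind _ _ x∈H y∈H) (x≢L , L⊆H)
    ∷ independent⇒pairwise ind uniq L⊆H

  prodSet-pairwise : ∀ {H} → Independent G H → AllPairs Commute (prodSet H)
  prodSet-pairwise {H} ind =
    independent⇒pairwise ind (Unique.filter⁺ (_∈? H) (Unique.allFin⁺ n)) (All.tabulate ∈-prodSet⁻)

  IsIA-unique : ∀ {w w' H H'} → w ≋ w' → IsIA G w H → IsIA G w' H' → H ≡ H'
  IsIA-unique w≋w' IA[w] IA[w'] =
    ⊆-antisym (λ x∈H → from (IA[w'] _) (InIA-≋ w≋w' (to (IA[w] _) x∈H)))
              (λ x∈H' → from (IA[w] _) (InIA-≋ (≈-sym w≋w') (to (IA[w'] _) x∈H')))
    where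
    open Equivalence
    InIA-≋ : ∀ {v v' x} → v ≋ v' → InIA G v x → InIA G v' x
    InIA-≋ v≋v' (z , v≋zx) = z , ≈-trans (≈-sym v≋v') v≋zx

module Paths {n : ℕ} (G : SimpleGraph n) where
  open SimpleGraph G
  open Words G
  open import Data.List.Membership.DecPropositional (_≟_ {n}) using () renaming (_∈?_ to _∈ₗ?_)

  InducedPath : Word → Set
  InducedPath []       = ⊤
  InducedPath (x ∷ ps) = InducedPath ps × All (x ≢_) ps × All (λ y → ¬ x ~ y) (drop 1 ps)

  Walk-suffix : ∀ {a b ps} l {y r} → Walk G a b ps → ps ≡ l ++ y ∷ r → Walk G y b (y ∷ r)
  Walk-suffix []           here        refl = here
  Walk-suffix []           (step e w)  refl = step e w
  Walk-suffix (_ ∷ [])     here        ()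
  Walk-suffix (_ ∷ _ ∷ _)  here        ()
  Walk-suffix (_ ∷ l)      (step _ w)  refl = Walk-suffix l w refl

  suffix-shorter : ∀ (l : Word) {y r} → length (y ∷ r) < suc (length (l ++ y ∷ r))
  suffix-shorter l {y} {r} = s≤s (subst (length (y ∷ r) ≤_) (sym (length-++ l)) (m≤n+m _ (length l)))

  ShorterWalk : Vertex → Vertex → ℕ → Set
  ShorterWalk a b k = ∃ λ qs → Walk G a b qs × length qs < k

  shortcut : ∀ {a c b ps} → Walk G c b ps → Any (a ~_) (drop 1 ps) → ShorterWalk a b (suc (length ps))
  shortcut {a} (step {a = c} e w) a~ with find a~
  ... | y , y∈ , a~y with ∈-∃++ y∈
  ...   | l , r , refl = a ∷ y ∷ r , step a~y (Walk-suffix (c ∷ l) (step e w) refl) , s≤s (suffix-shorter l)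

  induced-or-shorter : ∀ {a b ps} → Walk G a b ps → InducedPath ps ⊎ ShorterWalk a b (length ps)
  induced-or-shorter here = inj₁ (tt , [] , [])
  induced-or-shorter {a} (step {ps = ps} e w) with induced-or-shorter w
  ... | inj₂ (qs , w' , shorter) = inj₂ (a ∷ qs , step e w' , s≤s shorter)
  ... | inj₁ ind with a ∈ₗ? ps
  ...   | yes a∈ps with ∈-∃++ a∈ps
  ...     | l , r , refl = inj₂ (a ∷ r , Walk-suffix l w refl , suffix-shorter l)
  induced-or-shorter {a} (step {ps = ps} e w) | inj₁ ind | no a∉ps with any? (~-dec a) (drop 1 ps)
  ...     | no ¬chord = inj₁ (ind , All.¬Any⇒All¬ ps a∉ps , All.¬Any⇒All¬ (drop 1 ps) ¬chord)
  ...     | yes chord = inj₂ (shortcut w chord)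

  shortest⇒induced : ∀ {a b ps} → ShortestPath G a b ps → InducedPath ps
  shortest⇒induced (w , minimal) with induced-or-shorter w
  ... | inj₁ ind                 = ind
  ... | inj₂ (qs , w' , shorter) = ⊥-elim (<⇒≱ shorter (minimal qs w'))

  evenPos-⊆ : ∀ {x} (ps : Word) → x ∈ₗ evenPos ps → x ∈ₗ ps
  oddPos-⊆  : ∀ {x} (ps : Word) → x ∈ₗ oddPos ps → x ∈ₗ ps
  evenPos-⊆ (_ ∷ ps) x∈ = there (oddPos-⊆ ps x∈)
  oddPos-⊆  (_ ∷ ps) (here x≡y) = here x≡y
  oddPos-⊆  (_ ∷ ps) (there x∈) = there (evenPos-⊆ ps x∈)

  evenPos-⊆-drop₁ : ∀ {x} (ps : Word) → x ∈ₗ evenPos ps → x ∈ₗ drop 1 ps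
  evenPos-⊆-drop₁ (_ ∷ ps) x∈ = oddPos-⊆ ps x∈

  evenPos⊎oddPos : ∀ {x} (ps : Word) → x ∈ₗ ps → x ∈ₗ evenPos ps ⊎ x ∈ₗ oddPos ps
  evenPos⊎oddPos (_ ∷ ps) (here x≡y) = inj₂ (here x≡y)
  evenPos⊎oddPos (_ ∷ ps) (there x∈) with evenPos⊎oddPos ps x∈
  ... | inj₁ x∈e = inj₂ (there x∈e)
  ... | inj₂ x∈o = inj₁ x∈o

  evenPos-pairwise : ∀ (ps : Word) → InducedPath ps → AllPairs Commute (evenPos ps)
  oddPos-pairwise  : ∀ (ps : Word) → InducedPath ps → AllPairs Commute (oddPos ps)
  evenPos-pairwise []       _         = []
  evenPos-pairwise (_ ∷ ps) (ind , _) = oddPos-pairwise ps ind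
  oddPos-pairwise  []       _                   = []
  oddPos-pairwise  (x ∷ ps) (ind , distinct , chordless) =
    All.tabulate (λ y∈ → All.lookup distinct (evenPos-⊆ ps y∈)
                       , All.lookup chordless (evenPos-⊆-drop₁ ps y∈))
    ∷ evenPos-pairwise ps ind

  evenPos-oddPos-disjoint : ∀ {x} (ps : Word) → InducedPath ps → x ∈ₗ evenPos ps → x ∉ₗ oddPos ps
  evenPos-oddPos-disjoint (_ ∷ ps) (_ , distinct , _) x∈e (here refl) = All.lookup distinct (oddPos-⊆ ps x∈e) refl
  evenPos-oddPos-disjoint (_ ∷ ps) (ind , _)          x∈e (there x∈o) = evenPos-oddPos-disjoint ps ind x∈o x∈e

  start∈oddPos : ∀ {a b ps} → Walk G a b ps → a ∈ₗ oddPos ps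
  start∈oddPos here       = here refl
  start∈oddPos (step _ _) = here refl

  end∈ : ∀ {a b ps} → Walk G a b ps → b ∈ₗ ps
  end∈ here       = here refl
  end∈ (step _ w) = there (end∈ w)

  evenPos-neighbour    : ∀ {a b ps x} → Walk G a b ps → x ∈ₗ evenPos ps →
                         ∃ λ y → y ∈ₗ oddPos ps × x ~ y
  oddPos-neighbour-step : ∀ {a c b ps x} → a ~ c → Walk G c b ps → x ∈ₗ oddPos (a ∷ ps) →
                          ∃ λ y → y ∈ₗ evenPos (a ∷ ps) × x ~ y
  evenPos-neighbour (step a~c here) (here refl) = _ , here refl , ~-sym a~c
  evenPos-neighbour (step a~c (step c~d w)) x∈ with oddPos-neighbour-step c~d w x∈
  ... | y , y∈ , x~y = y , there y∈ , x~y
  oddPos-neighbour-step a~c w (here refl) = _ , start∈oddPos w , a~c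
  oddPos-neighbour-step a~c w (there x∈) = evenPos-neighbour w x∈

  oddPos-neighbour : ∀ {a b ps x} → a ≢ b → Walk G a b ps → x ∈ₗ oddPos ps →
                     ∃ λ y → y ∈ₗ evenPos ps × x ~ y
  oddPos-neighbour a≢a here       _ = ⊥-elim (a≢a refl)
  oddPos-neighbour _   (step e w) x∈ = oddPos-neighbour-step e w x∈

  ReachableIn : (Vertex → Set) → Vertex → Vertex → Set
  ReachableIn P a b = ∃ λ ps → Walk G a b ps × All P ps

  module _ {P : Vertex → Set} where

    walk-++ : ∀ {a b c ps} → Walk G a b ps → All P ps → ReachableIn P b c → ReachableIn P a c
    walk-++ here       _          r = r
    walk-++ (step e w) (pa ∷ pps) r with walk-++ w pps r
    ... | _ , w' , pqs = _ , step e w' , pa ∷ pqs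

    reachable-trans : ∀ {a b c} → ReachableIn P a b → ReachableIn P b c → ReachableIn P a c
    reachable-trans (_ , w , pps) = walk-++ w pps

    walk-start : ∀ {a b ps} → Walk G a b ps → All P ps → P a
    walk-start here       (pa ∷ _) = pa
    walk-start (step _ _) (pa ∷ _) = pa

    reachable-sym : ∀ {a b} → ReachableIn P a b → ReachableIn P b a
    reachable-sym (_ , here , pps) = _ , here , pps
    reachable-sym (_ , step e w , pa ∷ pps) =
      reachable-trans (reachable-sym (_ , w , pps)) (_ , step (~-sym e) here , walk-start w pps ∷ pa ∷ [])

  reachable-map : ∀ {P Q : Vertex → Set} → (∀ {x} → P x → Q x) →
                  ∀ {a b} → ReachableIn P a b → ReachableIn Q a b
  reachable-map P⊆Q (qs , w , pqs) = qs , w , All.map P⊆Q pqs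

  walk-prefix : ∀ {a b ps x} → Walk G a b ps → x ∈ₗ ps → ReachableIn (_∈ₗ ps) a x
  walk-prefix here       (here refl) = _ , here , here refl ∷ []
  walk-prefix (step _ _) (here refl) = _ , here , here refl ∷ []
  walk-prefix (step e w) (there x∈)  with walk-prefix w x∈
  ... | _ , w' , inside = _ , step e w' , here refl ∷ All.map there inside

module OneSide {n : ℕ} (G : SimpleGraph n) (c : Fin n) (p : List (Fin n))
               (p-pairwise : AllPairs (Words.Commute G) p) where
  open SimpleGraph G
  open Words G
  open import Data.List.Membership.DecPropositional (_≟_ {n}) using () renaming (_∈?_ to _∈ₗ?_)

  Z : Subset n → Vertex → Set
  Z H x = (∃[ y ] (y ∈ H × ¬ (y ∈ₗ p) × N[ G ] y x))
        ⊎ ((∃[ y ] (y ∈ H × N[ G ] y x)) × N[ G ] c x)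

  offPath : Subset n → Word
  offPath H = filter (λ z → (z ∈? H) ×-dec ¬? (z ∈ₗ? p)) (allFin n)

  ∈-offPath⁺ : ∀ {H z} → z ∈ H → z ∉ₗ p → z ∈ₗ offPath H
  ∈-offPath⁺ {H} {z} z∈H z∉p = ∈-filter⁺ (λ z → (z ∈? H) ×-dec ¬? (z ∈ₗ? p)) (∈-allFin z) (z∈H , z∉p)

  ∈-offPath⁻ : ∀ {H z} → z ∈ₗ offPath H → z ∈ H × z ∉ₗ p
  ∈-offPath⁻ {H} z∈ = proj₂ (∈-filter⁻ (λ z → (z ∈? H) ×-dec ¬? (z ∈ₗ? p)) {xs = allFin n} z∈)

  offPath-pairwise : ∀ {H} → Independent G H → AllPairs Commute (offPath H)
  offPath-pairwise ind =
    independent⇒pairwise ind (Unique.filter⁺ _ (Unique.allFin⁺ n)) (All.tabulate (proj₁ ∘ ∈-offPath⁻))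

  offPath++p≋prodSet : ∀ {H} → Independent G H → (∀ z → z ∈ₗ p → z ∈ H) → offPath H ++ p ≋ prodSet H
  offPath++p≋prodSet {H} ind p⊆H =
    commuting-≋ (offPath H ++ p) (prodSet H)
      (AllPairs.++⁺ (offPath-pairwise ind) p-pairwise (All.tabulate offPath⋈p))
      (prodSet-pairwise ind) ⊆ˡ ⊆ʳ
    where
    offPath⋈p : ∀ {y} → y ∈ₗ offPath H → All (Commute y) p
    offPath⋈p y∈ with ∈-offPath⁻ y∈
    ... | y∈H , y∉p = All.tabulate λ z∈p →
      (λ { refl → y∉p z∈p }) , ind _ _ y∈H (p⊆H _ z∈p)
    ⊆ˡ : ∀ {x} → x ∈ₗ prodSet H → x ∈ₗ offPath H ++ p
    ⊆ˡ {x} x∈ with x ∈ₗ? p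
    ... | yes x∈p = ∈-++⁺ʳ (offPath H) x∈p
    ... | no x∉p  = ∈-++⁺ˡ (∈-offPath⁺ (∈-prodSet⁻ x∈) x∉p)
    ⊆ʳ : ∀ {x} → x ∈ₗ offPath H ++ p → x ∈ₗ prodSet H
    ⊆ʳ {x} x∈ with ∈-++⁻ (offPath H) x∈
    ... | inj₁ x∈off = ∈-prodSet⁺ (proj₁ (∈-offPath⁻ x∈off))
    ... | inj₂ x∈p   = ∈-prodSet⁺ (p⊆H x x∈p)

  module Forward (w : Word) (w-near : ∀ {z} → Final z w → N[ G ] c z) where

    H : Subset n
    H = subsetOf (λ z → final? z (w ++ p))

    Final⇒∈H : ∀ {z} → Final z (w ++ p) → z ∈ H
    Final⇒∈H = ∈-subsetOf⁺ (λ z → final? z (w ++ p))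

    ∈H⇒Final : ∀ {z} → z ∈ H → Final z (w ++ p)
    ∈H⇒Final = ∈-subsetOf⁻ (λ z → final? z (w ++ p))

    IA : IsIA G (w ++ p) H
    IA z = mk⇔ (Final⇒InIA ∘ ∈H⇒Final) (Final⇒∈H ∘ InIA⇒Final)

    independent : Independent G H
    independent a b a∈H b∈H = Final-independent (∈H⇒Final a∈H) (∈H⇒Final b∈H)

    p⊆H : ∀ z → z ∈ₗ p → z ∈ H
    p⊆H z z∈p = Final⇒∈H (Final-++⁺ʳ w (AllPairs⇒Final p-pairwise z∈p))

    offPath-final : ∀ {z} → z ∈ H → z ∉ₗ p → Final z w × All (Commute z) p
    offPath-final z∈H z∉p with Final-++⁻ w (∈H⇒Final z∈H)
    ... | inj₁ fzp = ⊥-elim (z∉p (Final⇒∈ fzp))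
    ... | inj₂ fzw = fzw

    offPath-near : ∀ z → z ∈ H → z ∉ₗ p → N[ G ] c z
    offPath-near z z∈H z∉p = w-near (proj₁ (offPath-final z∈H z∉p))

    offPath-commutes : ∀ z → z ∈ H → z ∉ₗ p → All (Commute z) p
    offPath-commutes z z∈H z∉p = proj₂ (offPath-final z∈H z∉p)

    private
      split : ∃ λ w₀ → w ≋ w₀ ++ offPath H
      split = factor-finals w (offPath H) (offPath-pairwise independent)
                (All.tabulate λ z∈ → proj₁ (uncurry offPath-final (∈-offPath⁻ z∈)))

    w₀ : Word
    w₀ = proj₁ split

    w≋w₀++offPath : w ≋ w₀ ++ offPath H
    w≋w₀++offPath = proj₂ split

    factorisation : w ++ p ≋ w₀ ++ prodSet H
    factorisation = ≈-trans (≋-++ʳ p w≋w₀++offPath)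
      (subst (_≋ w₀ ++ prodSet H) (sym (++-assoc w₀ (offPath H) p))
        (≋-++ˡ w₀ (offPath++p≋prodSet independent p⊆H)))

    w₀∈P∅ : InP∅ G (Z H) w₀
    w₀∈P∅ z z∈IA with blocked-or-commutes z (offPath H)
    ... | inj₁ (y , y∈off , y-z) = inj₁ (y , proj₁ (∈-offPath⁻ y∈off) , proj₂ (∈-offPath⁻ y∈off) , y-z)
    ... | inj₂ z⋈off = inj₂ (H-near , w-near fzw)
      where
      fzw₀ : Final z w₀
      fzw₀ = InIA⇒Final z∈IA
      fzw : Final z w
      fzw = Final-resp-≋ (≈-sym w≋w₀++offPath) (Final-++⁺ˡ fzw₀ z⋈off)
      H-near : ∃[ y ] (y ∈ H × N[ G ] y z)
      H-near with blocked-or-commutes z (prodSet H)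
      ... | inj₁ (y , y∈H , y-z) = y , ∈-prodSet⁻ y∈H , y-z
      ... | inj₂ z⋈H =
        z , Final⇒∈H (Final-resp-≋ (≈-sym factorisation) (Final-++⁺ˡ fzw₀ z⋈H)) , inj₁ refl

  module Backward (H : Subset n) (independent : Independent G H) (p⊆H : ∀ z → z ∈ₗ p → z ∈ H)
                  (offPath-near : ∀ z → z ∈ H → z ∉ₗ p → N[ G ] c z)
                  (a : Word) (a∈P∅ : InP∅ G (Z H) a) where

    w : Word
    w = a ++ offPath H

    factorisation : w ++ p ≋ a ++ prodSet H
    factorisation = subst (_≋ a ++ prodSet H) (sym (++-assoc a (offPath H) p))
                      (≋-++ˡ a (offPath++p≋prodSet independent p⊆H))

    final-a-near-H : ∀ {z} → Final z a → ∃ λ y → y ∈ H × N[ G ] y z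
    final-a-near-H fz with a∈P∅ _ (Final⇒InIA fz)
    ... | inj₁ (y , y∈H , _ , y-z) = y , y∈H , y-z
    ... | inj₂ (near , _)          = near

    IA : IsIA G (w ++ p) H
    IA z = mk⇔ (λ z∈H → Final⇒InIA (Final-resp-≋ (≈-sym factorisation)
                          (Final-++⁺ʳ a (AllPairs⇒Final (prodSet-pairwise independent) (∈-prodSet⁺ z∈H)))))
               (∈H ∘ Final-resp-≋ factorisation ∘ InIA⇒Final)
      where
      ∈H : Final z (a ++ prodSet H) → z ∈ H
      ∈H fz with Final-++⁻ a fz
      ... | inj₁ fzH          = ∈-prodSet⁻ (Final⇒∈ fzH)
      ... | inj₂ (fza , z⋈H) with final-a-near-H fza
      ...   | y , y∈H , y-z = ⊥-elim (N⇒¬commute y-z (All.lookup z⋈H (∈-prodSet⁺ y∈H)))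

    w∷c∈P∅ : InP∅ G (_≡ c) (w ++ [ c ])
    w∷c∈P∅ z z∈IA with Final-++⁻ w (InIA⇒Final z∈IA)
    ... | inj₁ (here _)                = refl
    ... | inj₂ (fzw , z⋈c ∷ []) with Final-++⁻ a fzw
    ...   | inj₁ fzoff with ∈-offPath⁻ (Final⇒∈ fzoff)
    ...     | z∈H , z∉p = ⊥-elim (N⇒¬commute (offPath-near z z∈H z∉p) z⋈c)
    w∷c∈P∅ z z∈IA | inj₂ (fzw , z⋈c ∷ []) | inj₂ (fza , z⋈off) with a∈P∅ z (Final⇒InIA fza)
    ...     | inj₁ (y , y∈H , y∉p , y-z) =
      ⊥-elim (N⇒¬commute y-z (All.lookup z⋈off (∈-offPath⁺ y∈H y∉p)))
    ...     | inj₂ (_ , c-z)             = ⊥-elim (N⇒¬commute c-z z⋈c)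

  image-unique : ∀ {w w₂ H H₂ a a₂} → w ++ [ c ] ≋ w₂ ++ [ c ] →
                 IsIA G (w ++ p) H → IsIA G (w₂ ++ p) H₂ →
                 w ++ p ≋ a ++ prodSet H → w₂ ++ p ≋ a₂ ++ prodSet H₂ → H ≡ H₂ × a ≋ a₂
  image-unique {w} {w₂} {H} {H₂} {a} {a₂} wc≋w₂c IA IA₂ f f₂ =
    H≡H₂ , ++-cancelʳ-≋ (prodSet H) a a₂ (≈-trans (≈-sym f) (≈-trans wp≋w₂p f₂′))
    where
    wp≋w₂p : w ++ p ≋ w₂ ++ p
    wp≋w₂p = ≋-++ʳ p (∷ʳ-cancel-≋ w w₂ wc≋w₂c)
    H≡H₂ : H ≡ H₂
    H≡H₂ = IsIA-unique wp≋w₂p IA IA₂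
    f₂′ : w₂ ++ p ≋ a₂ ++ prodSet H
    f₂′ = subst (λ K → w₂ ++ p ≋ a₂ ++ prodSet K) (sym H≡H₂) f₂

  image-injective : ∀ {w w₂ H a a₂} → w ++ p ≋ a ++ prodSet H → w₂ ++ p ≋ a₂ ++ prodSet H →
                    a ≋ a₂ → w ++ [ c ] ≋ w₂ ++ [ c ]
  image-injective {w} {w₂} {H} f f₂ a≋a₂ =
    ≋-++ʳ [ c ] (++-cancelʳ-≋ p w w₂ (≈-trans f (≈-trans (≋-++ʳ (prodSet H) a≋a₂) (≈-sym f₂))))

module Proposition41 {n : ℕ} (G : SimpleGraph n) (u v : Fin n) (u≢v : u ≢ v)
                     (ps : List (Fin n)) (shortest : ShortestPath G u v ps) where
  open SimpleGraph G
  open Words G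
  open Paths G
  open Prop41 G u v ps
  open import Data.List.Membership.DecPropositional (_≟_ {n}) using () renaming (_∈?_ to _∈ₗ?_)

  path : Walk G u v ps
  path = proj₁ shortest

  induced : InducedPath ps
  induced = shortest⇒induced shortest

  module Even = OneSide G u 𝐞 (evenPos-pairwise ps induced)
  module Odd  = OneSide G v 𝐨 (oddPos-pairwise ps induced)

  ℋ-disjoint : ∀ {H₁ H₂} → (∀ z → z ∈ H₁ → ¬ InE z → N[ G ] u z) →
               (∀ z → z ∈ H₁ → ¬ InE z → All (Commute z) 𝐞) →
               (∀ z → z ∈ H₂ → ¬ InO z → All (Commute z) 𝐨) →
               ∀ z → z ∈ H₁ → z ∉ H₂
  ℋ-disjoint near₁ ⋈₁ ⋈₂ z z∈H₁ z∈H₂ with z ∈ₗ? 𝐞 | z ∈ₗ? 𝐨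
  ... | yes z∈E | yes z∈O = evenPos-oddPos-disjoint ps induced z∈E z∈O
  ... | yes z∈E | no z∉O with evenPos-neighbour path z∈E
  ...   | y , y∈O , z~y = proj₂ (All.lookup (⋈₂ z z∈H₂ z∉O) y∈O) z~y
  ℋ-disjoint near₁ ⋈₁ ⋈₂ z z∈H₁ z∈H₂ | no z∉E | yes z∈O with oddPos-neighbour u≢v path z∈O
  ...   | y , y∈E , z~y = proj₂ (All.lookup (⋈₁ z z∈H₁ z∉E) y∈E) z~y
  ℋ-disjoint near₁ ⋈₁ ⋈₂ z z∈H₁ z∈H₂ | no z∉E | no z∉O =
    N⇒¬commute (near₁ z z∈H₁ z∉E) (All.lookup (⋈₂ z z∈H₂ z∉O) (start∈oddPos path))

  ℋ-connected : ∀ {H₁ H₂} → (∀ x → InE x → x ∈ H₁) → (∀ x → InO x → x ∈ H₂) →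
                (∀ x → x ∈ H₁ → ¬ InE x → N[ G ] u x) →
                (∀ x → x ∈ H₂ → ¬ InO x → N[ G ] v x) →
                InducedConnected G (H₁ ∪ H₂)
  ℋ-connected {H₁} {H₂} E⊆H₁ O⊆H₂ near₁ near₂ a b a∈S b∈S =
    reachable-trans (reachable-sym (from-u a∈S)) (from-u b∈S)
    where
    ps⊆S : ∀ {z} → z ∈ₗ ps → z ∈ H₁ ∪ H₂
    ps⊆S z∈ = either (x∈p∪q⁺ ∘ inj₁ ∘ E⊆H₁ _) (x∈p∪q⁺ ∘ inj₂ ∘ O⊆H₂ _) (evenPos⊎oddPos ps z∈)

    along-path : ∀ {z} → z ∈ₗ ps → ReachableIn (_∈ H₁ ∪ H₂) u z
    along-path z∈ = reachable-map ps⊆S (walk-prefix path z∈)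

    near-path : ∀ {x z} → x ∈ₗ ps → N[ G ] x z → z ∈ H₁ ∪ H₂ → ReachableIn (_∈ H₁ ∪ H₂) u z
    near-path x∈ (inj₁ refl) _   = along-path x∈
    near-path x∈ (inj₂ x~z)  z∈S =
      reachable-trans (along-path x∈) (_ , step x~z here , ps⊆S x∈ ∷ z∈S ∷ [])

    from-u : ∀ {z} → z ∈ H₁ ∪ H₂ → ReachableIn (_∈ H₁ ∪ H₂) u z
    from-u {z} z∈S with x∈p∪q⁻ H₁ H₂ z∈S | z ∈ₗ? 𝐞 | z ∈ₗ? 𝐨
    ... | inj₁ _    | yes z∈E | _      = along-path (evenPos-⊆ ps z∈E)
    ... | inj₁ z∈H₁ | no z∉E  | _      = near-path (oddPos-⊆ ps (start∈oddPos path)) (near₁ z z∈H₁ z∉E) z∈S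
    ... | inj₂ _    | _       | yes z∈O = along-path (oddPos-⊆ ps z∈O)
    ... | inj₂ z∈H₂ | _       | no z∉O  = near-path (end∈ path) (near₂ z z∈H₂ z∉O) z∈S

  forward : ∀ x y → InDomain x y → ∃[ t ] (InCodomain t × Maps x y t)
  forward x y (x∈P , y∈P) with InP-single⇒∷ʳ u x x∈P | InP-single⇒∷ʳ v y y∈P
  ... | w , x≋wu | w' , y≋w'v =
    (F₁.H , F₂.H , F₁.w₀ , F₂.w₀) ,
    ( ( ℋ-disjoint F₁.offPath-near F₁.offPath-commutes F₂.offPath-commutes
      , F₁.independent , F₂.independent
      , ℋ-connected F₁.p⊆H F₂.p⊆H F₁.offPath-near F₂.offPath-near
      , F₁.p⊆H , F₂.p⊆H , F₁.offPath-near , F₂.offPath-near )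
    , F₁.w₀∈P∅ , F₂.w₀∈P∅ ) ,
    (w , w' , x≋wu , y≋w'v , F₁.IA , F₂.IA , F₁.factorisation , F₂.factorisation)
    where
    module F₁ = Even.Forward w  (Final⇒N (InP∅-resp-≋ x≋wu  (proj₂ x∈P)))
    module F₂ = Odd.Forward  w' (Final⇒N (InP∅-resp-≋ y≋w'v (proj₂ y∈P)))

  single-valued : ∀ x y x' y' t t' → InDomain x y → InDomain x' y' →
                  Maps x y t → Maps x' y' t' → x ≋ x' → y ≋ y' → t ≈T t'
  single-valued x y x' y' t t' _ _
    (w  , w'  , x≋wu  , y≋w'v  , IA₁  , IA₂  , f₁  , f₂)
    (w₂ , w₂' , x'≋w₂u , y'≋w₂'v , IA₁' , IA₂' , f₁' , f₂') x≋x' y≋y'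
    with Even.image-unique (≈-trans (≈-sym x≋wu) (≈-trans x≋x' x'≋w₂u)) IA₁ IA₁' f₁ f₁'
       | Odd.image-unique (≈-trans (≈-sym y≋w'v) (≈-trans y≋y' y'≋w₂'v)) IA₂ IA₂' f₂ f₂'
  ... | H₁≡ , a≋ | H₂≡ , b≋ = H₁≡ , H₂≡ , a≋ , b≋

  injective : ∀ x y x' y' t t' → InDomain x y → InDomain x' y' →
              Maps x y t → Maps x' y' t' → t ≈T t' → x ≋ x' × y ≋ y'
  injective x y x' y' (H₁ , H₂ , _) (_ , _ , _) _ _
    (w  , w'  , x≋wu  , y≋w'v  , _ , _ , f₁  , f₂)
    (w₂ , w₂' , x'≋w₂u , y'≋w₂'v , _ , _ , f₁' , f₂') (refl , refl , a≋ , b≋) =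
    ≈-trans x≋wu (≈-trans (Even.image-injective f₁ f₁' a≋) (≈-sym x'≋w₂u)) ,
    ≈-trans y≋w'v (≈-trans (Odd.image-injective f₂ f₂' b≋) (≈-sym y'≋w₂'v))

  surjective : ∀ t → InCodomain t → ∃[ x ] ∃[ y ] (InDomain x y × Maps x y t)
  surjective (H₁ , H₂ , a , b)
             ((_ , ind₁ , ind₂ , _ , E⊆H₁ , O⊆H₂ , near₁ , near₂) , a∈P∅ , b∈P∅) =
    B₁.w ++ [ u ] , B₂.w ++ [ v ] ,
    ((∷ʳ≢[] B₁.w u , B₁.w∷c∈P∅) , (∷ʳ≢[] B₂.w v , B₂.w∷c∈P∅)) ,
    (B₁.w , B₂.w , ≈-refl , ≈-refl , B₁.IA , B₂.IA , B₁.factorisation , B₂.factorisation)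
    where
    module B₁ = Even.Backward H₁ ind₁ E⊆H₁ near₁ a a∈P∅
    module B₂ = Odd.Backward  H₂ ind₂ O⊆H₂ near₂ b b∈P∅

proposition4p1 : ∀ {n} (G : SimpleGraph n) → Connected G →
    (u v : Fin n) → u ≢ v → (ps : List (Fin n)) → ShortestPath G u v ps →
    Prop41.WellDefinedBijection G u v ps
proposition4p1 G _ u v u≢v ps shortest =
  InP-single⇒∷ʳ u , ∷ʳ-cancel-≋ , InP-single⇒∷ʳ v , ∷ʳ-cancel-≋ ,
  forward , single-valued , injective , surjective
  where
  open Words G
  open Proposition41 G u v u≢v ps shortest
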